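{- Let $G=(V,E)$ be a finite undirected graph, $\mathcal{B}$ a finite family of non-empty subsets of $V$ such that each vertex of $V$ is contained in some member of $\mathcal{B}$, and $w\colon\mathcal{B}\to\mathbb{Z}_{>0}$. Then every proper coloring $c\colon V\to\mathbb{Z}_{>0}$ that minimizes $\mathrm{cost}(c)=\sum_{B\in\mathcal{B}}w(B)\max\{c(v)\mid v\in B\}$ among all proper colorings of $G$ satisfies $c(v)\le\chi(G)\,|\mathcal{B}|$ for all $v\in V$.
   Context: A proper coloring is a map $c\colon V\to\mathbb{Z}_{>0}$ with $c(u)\ne c(v)$ for every edge $uv\in E$. $\chi(G)$ is the chromatic number of $G$, i.e. the minimum of $\max_{v\in V}c(v)$ over all proper colorings $c$ of $G$. -}

module Defs where

open import Data.Nat using (ℕ; zero; suc; _+_; _*_; _≤_; _<_; _⊔_)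
open import Data.Fin using (Fin)
open import Data.Fin.Subset using (Subset; _∈_)
open import Data.Vec.Functional using (foldr)
open import Data.Product using (_×_; ∃)
open import Relation.Nullary using (¬_)
open import Relation.Binary.PropositionalEquality using (_≡_; _≢_)
open import Data.Bool using (if_then_else_)
open import Data.Vec using (lookup)

record Graph (n : ℕ) : Set₁ where
  field
    Adj   : Fin n → Fin n → Set
    sym   : ∀ {u v} → Adj u v → Adj v u
    irrefl : ∀ {v} → ¬ Adj v v

open Graph public

IsProperColoring : ∀ {n} → Graph n → (Fin n → ℕ) → Set
IsProperColoring {n} G c =
  (∀ v → 1 ≤ c v) × (∀ u v → Adj G u v → c u ≢ c v)

Colorable : ∀ {n} → Graph n → ℕ → Set
Colorable {n} G k = ∃ λ (c : Fin n → ℕ) → IsProperColoring G c × (∀ v → c v ≤ k)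

IsChromaticNumber : ∀ {n} → Graph n → ℕ → Set
IsChromaticNumber G k = Colorable G k × (∀ j → Colorable G j → k ≤ j)

-- max { c v | v ∈ B }  (0 for empty B, which does not occur below)
maxOn : ∀ {n} → (Fin n → ℕ) → Subset n → ℕ
maxOn {n} c B = foldr _⊔_ 0 (λ v → if lookup B v then c v else 0)

sumFin : ∀ {m} → (Fin m → ℕ) → ℕ
sumFin {m} f = foldr _+_ 0 f

cost : ∀ {n m} → (Fin m → Subset n) → (Fin m → ℕ) → (Fin n → ℕ) → ℕ
cost B w c = sumFin λ i → w i * maxOn c (B i)

{-# OPTIONS --safe #-}
module Submission where

-- Write M j for the largest colour on block j of an optimal colouring c, and fix a proper
-- colouring φ with colours in {1, …, k}. If some M i exceeds y but no M j lies in (y, y + k],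
-- recolour every vertex with colour in (y, M i] by y + φ: this stays proper, lowers no block
-- maximum and lowers M i, contradicting optimality. So each of the m + 1 intervals
-- (k t, k t + k] with t ≤ m contains some M j as soon as some M i exceeds k m; as these
-- intervals are disjoint and there are only m blocks, no M i exceeds k m.

open import Defs hiding (sym)
open import Data.Bool using (true; false; if_then_else_)
open import Data.Empty using (⊥-elim)
open import Data.Fin using (Fin; toℕ)
open import Data.Fin.Properties using (any?; pigeonhole; toℕ≤pred[n])
open import Data.Fin.Subset using (Subset; _∈_)
open import Data.Nat using (ℕ; zero; suc; _+_; _*_; _≤_; _<_; _⊔_; z≤n; _≤?_; _<?_; >-nonZero)
open import Data.Nat.Properties
open import Data.Product using (∃; ∃₂; _×_; _,_; proj₁; proj₂)
open import Data.Vec using (lookup)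
open import Data.Vec.Functional using (foldr; tail)
open import Data.Vec.Properties using ([]=⇒lookup; lookup⇒[]=)
open import Function using (_∘_)
open import Function.Definitions using (Injective)
open import Relation.Binary.PropositionalEquality using (_≡_; _≢_; refl; sym; cong; subst)
open import Relation.Nullary using (¬_; Dec; yes; no)
open import Relation.Nullary.Decidable using (_×-dec_)

≤-foldr-⊔ : ∀ {n} (f : Fin n → ℕ) i → f i ≤ foldr _⊔_ 0 f
≤-foldr-⊔ f Fin.zero    = m≤m⊔n _ _
≤-foldr-⊔ f (Fin.suc i) = ≤-trans (≤-foldr-⊔ (tail f) i) (m≤n⊔m _ _)

foldr-⊔-lub : ∀ {n} (f : Fin n → ℕ) {x} → (∀ i → f i ≤ x) → foldr _⊔_ 0 f ≤ x
foldr-⊔-lub {zero}  f f≤x = z≤n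
foldr-⊔-lub {suc n} f f≤x = ⊔-lub (f≤x Fin.zero) (foldr-⊔-lub (tail f) (f≤x ∘ Fin.suc))

≤-maxOn : ∀ {n} (c : Fin n → ℕ) {B v} → v ∈ B → c v ≤ maxOn c B
≤-maxOn c {B} {v} v∈B
  with ≤-foldr-⊔ (λ u → if lookup B u then c u else 0) v
... | le rewrite []=⇒lookup v∈B = le

maxOn-lub : ∀ {n} (c : Fin n → ℕ) B {x} → (∀ {v} → v ∈ B → c v ≤ x) → maxOn c B ≤ x
maxOn-lub c B {x} c≤x = foldr-⊔-lub _ bounded
  where
  bounded : ∀ v → (if lookup B v then c v else 0) ≤ x
  bounded v with lookup B v in eq
  ... | true  = c≤x (lookup⇒[]= v B eq)
  ... | false = z≤n

sumFin-mono-≤ : ∀ {m} {f g : Fin m → ℕ} → (∀ i → f i ≤ g i) → sumFin f ≤ sumFin g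
sumFin-mono-≤ {zero}  f≤g = z≤n
sumFin-mono-≤ {suc m} f≤g = +-mono-≤ (f≤g Fin.zero) (sumFin-mono-≤ (f≤g ∘ Fin.suc))

sumFin-mono-< : ∀ {m} {f g : Fin m → ℕ} → (∀ i → f i ≤ g i) → ∀ i → f i < g i → sumFin f < sumFin g
sumFin-mono-< f≤g Fin.zero    fi<gi = +-mono-<-≤ fi<gi (sumFin-mono-≤ (f≤g ∘ Fin.suc))
sumFin-mono-< f≤g (Fin.suc i) fi<gi = +-mono-≤-< (f≤g Fin.zero) (sumFin-mono-< (f≤g ∘ Fin.suc) i fi<gi)

cost-< : ∀ {n m} (B : Fin m → Subset n) (w : Fin m → ℕ) {c c′ : Fin n → ℕ} →
         (∀ j → maxOn c′ (B j) ≤ maxOn c (B j)) →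
         ∀ i → 1 ≤ w i → maxOn c′ (B i) < maxOn c (B i) → cost B w c′ < cost B w c
cost-< B w max≤ i 1≤wi max< =
  sumFin-mono-< (λ j → *-monoʳ-≤ (w j) (max≤ j)) i (*-monoʳ-< (w i) {{>-nonZero 1≤wi}} max<)

GapsAtMost : ∀ {m} → ℕ → (Fin m → ℕ) → Set
GapsAtMost k M = ∀ y → (∃ λ i → y < M i) → ∃ λ j → y < M j × M j ≤ y + k

gapsAtMost⇒≤* : ∀ {m k} {M : Fin m → ℕ} → GapsAtMost k M → ∀ i → M i ≤ k * m
gapsAtMost⇒≤* {m} {k} {M} gaps i with M i ≤? k * m
... | yes Mi≤km = Mi≤km
... | no  Mi≰km = ⊥-elim (collision (pigeonhole ≤-refl (proj₁ ∘ landing)))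
  where
  landing : (t : Fin (suc m)) → ∃ λ j → k * toℕ t < M j × M j ≤ k * toℕ t + k
  landing t = gaps (k * toℕ t) (i , ≤-<-trans (*-monoʳ-≤ k (toℕ≤pred[n] t)) (≰⇒> Mi≰km))

  collision : ¬ ∃₂ λ t t′ → toℕ t < toℕ t′ × proj₁ (landing t) ≡ proj₁ (landing t′)
  collision (t , t′ , t<t′ , same) = <-irrefl refl (begin-strict
    M (proj₁ (landing t))    ≤⟨ proj₂ (proj₂ (landing t)) ⟩
    k * toℕ t + k            ≡⟨ +-comm (k * toℕ t) k ⟩
    k + k * toℕ t            ≡⟨ *-suc k (toℕ t) ⟨
    k * suc (toℕ t)          ≤⟨ *-monoʳ-≤ k t<t′ ⟩
    k * toℕ t′               <⟨ proj₁ (proj₂ (landing t′)) ⟩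
    M (proj₁ (landing t′))   ≡⟨ cong M same ⟨
    M (proj₁ (landing t))    ∎)
    where open ≤-Reasoning

-- The shifted colours y + φ v lie in (y, y + k] ⊆ (y, Z], so they never meet an unchanged colour.
module Recolouring {n} (G : Graph n) {c φ : Fin n → ℕ} {k}
  (c-proper : IsProperColoring G c) (φ-proper : IsProperColoring G φ) (φ≤k : ∀ v → φ v ≤ k)
  (y : ℕ) {Z} (y+k≤Z : y + k ≤ Z) where

  InWindow : ℕ → Set
  InWindow a = y < a × a ≤ Z

  inWindow? : ∀ a → Dec (InWindow a)
  inWindow? a = y <? a ×-dec a ≤? Z

  recolour : Fin n → ℕ
  recolour v with inWindow? (c v)
  ... | yes _ = y + φ v
  ... | no  _ = c v

  shifted≤y+k : ∀ v → y + φ v ≤ y + k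
  shifted≤y+k v = +-monoʳ-≤ y (φ≤k v)

  shifted∈window : ∀ v → InWindow (y + φ v)
  shifted∈window v = m<m+n y (proj₁ φ-proper v) , ≤-trans (shifted≤y+k v) y+k≤Z

  recolour-proper : IsProperColoring G recolour
  recolour-proper = positive , distinct
    where
    positive : ∀ v → 1 ≤ recolour v
    positive v with inWindow? (c v)
    ... | yes _ = ≤-<-trans z≤n (proj₁ (shifted∈window v))
    ... | no  _ = proj₁ c-proper v

    distinct : ∀ u v → Adj G u v → recolour u ≢ recolour v
    distinct u v uv with inWindow? (c u) | inWindow? (c v)
    ... | yes _   | yes _   = proj₂ φ-proper u v uv ∘ +-cancelˡ-≡ y _ _
    ... | yes _   | no  v∉W = λ eq → v∉W (subst InWindow eq (shifted∈window u))
    ... | no  u∉W | yes _   = λ eq → u∉W (subst InWindow (sym eq) (shifted∈window v))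
    ... | no  _   | no  _   = proj₂ c-proper u v uv

  recolour-below : ∀ {v} → c v ≤ y → recolour v ≡ c v
  recolour-below {v} cv≤y with inWindow? (c v)
  ... | yes (y<cv , _) = ⊥-elim (<⇒≱ y<cv cv≤y)
  ... | no  _          = refl

  recolour-≤-⊔ : ∀ v → recolour v ≤ c v ⊔ (y + k)
  recolour-≤-⊔ v with inWindow? (c v)
  ... | yes _ = ≤-trans (shifted≤y+k v) (m≤n⊔m (c v) (y + k))
  ... | no  _ = m≤m⊔n (c v) (y + k)

  recolour-≤-y+k : ∀ {v} → c v ≤ Z → recolour v ≤ y + k
  recolour-≤-y+k {v} cv≤Z with inWindow? (c v)
  ... | yes _ = shifted≤y+k v
  ... | no  v∉W with y <? c v
  ...   | yes y<cv = ⊥-elim (v∉W (y<cv , cv≤Z))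
  ...   | no  y≮cv = ≤-trans (≮⇒≥ y≮cv) (m≤m+n y k)

  maxOn-recolour-≤ : ∀ B → ¬ (y < maxOn c B × maxOn c B ≤ y + k) → maxOn recolour B ≤ maxOn c B
  maxOn-recolour-≤ B no-gap with maxOn c B ≤? y
  ... | yes max≤y = maxOn-lub recolour B λ v∈B →
          subst (_≤ maxOn c B) (sym (recolour-below (≤-trans (≤-maxOn c v∈B) max≤y))) (≤-maxOn c v∈B)
  ... | no  max≰y = maxOn-lub recolour B λ {v} v∈B →
          ≤-trans (recolour-≤-⊔ v) (⊔-lub (≤-maxOn c v∈B) (<⇒≤ (≰⇒> (no-gap ∘ (≰⇒> max≰y ,_)))))

  maxOn-recolour-≤-y+k : ∀ B → maxOn c B ≤ Z → maxOn recolour B ≤ y + k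
  maxOn-recolour-≤-y+k B max≤Z = maxOn-lub recolour B λ v∈B → recolour-≤-y+k (≤-trans (≤-maxOn c v∈B) max≤Z)

optimal⇒gapsAtMost : ∀ {n m} (G : Graph n) (B : Fin m → Subset n) (w : Fin m → ℕ) →
                     (∀ i → 1 ≤ w i) →
                     ∀ {c} → IsProperColoring G c →
                     (∀ c′ → IsProperColoring G c′ → cost B w c ≤ cost B w c′) →
                     ∀ {k} → Colorable G k → GapsAtMost k (λ j → maxOn c (B j))
optimal⇒gapsAtMost G B w w-pos {c} c-proper c-optimal {k} (φ , φ-proper , φ≤k) y (i , y<Mi)
  with any? (λ j → y <? maxOn c (B j) ×-dec maxOn c (B j) ≤? y + k)
... | yes gap   = gap
... | no no-gap = ⊥-elim (<⇒≱ cheaper (c-optimal recolour recolour-proper))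
  where
  y+k<Mi : y + k < maxOn c (B i)
  y+k<Mi = ≰⇒> λ Mi≤y+k → no-gap (i , y<Mi , Mi≤y+k)

  open Recolouring G c-proper φ-proper φ≤k y (<⇒≤ y+k<Mi)

  cheaper : cost B w recolour < cost B w c
  cheaper = cost-< B w (λ j → maxOn-recolour-≤ (B j) (no-gap ∘ (j ,_))) i (w-pos i)
                     (≤-<-trans (maxOn-recolour-≤-y+k (B i) ≤-refl) y+k<Mi)

lemma4 : ∀ {n m} (G : Graph n) (B : Fin m → Subset n) (w : Fin m → ℕ) →
    Injective _≡_ _≡_ B →
    (∀ i → ∃ λ v → v ∈ B i) →
    (∀ v → ∃ λ i → v ∈ B i) →
    (∀ i → 1 ≤ w i) →
    (c : Fin n → ℕ) → IsProperColoring G c →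
    (∀ c′ → IsProperColoring G c′ → cost B w c ≤ cost B w c′) →
    (k : ℕ) → IsChromaticNumber G k →
    ∀ v → c v ≤ k * m
lemma4 G B w _ _ covered w-pos c c-proper c-optimal k (k-colorable , _) v
  with covered v
... | i , v∈Bi = ≤-trans (≤-maxOn c v∈Bi) (gapsAtMost⇒≤* gaps i)
  where
  gaps : GapsAtMost k (λ j → maxOn c (B j))
  gaps = optimal⇒gapsAtMost G B w w-pos c-proper c-optimal k-colorable
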